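{- Let $q\not\equiv0\pmod3$. The line $L$ of $\mathrm{PG}(3,q)$ through $\mathrm{P}(1,0,0,1)$ and $\mathrm{P}(0,0,1,0)$ is an $E_n\Gamma$-line.
   Context: $\mathrm{P}(x_0,x_1,x_2,x_3)$ denotes a point of $\mathrm{PG}(3,q)$ in homogeneous coordinates. The twisted cubic is $\mathcal{C}=\{P(t): t\in\mathbb{F}_q\cup\{\infty\}\}$, $P(t)=\mathrm{P}(t^3,t^2,t,1)$ for $t\in\mathbb{F}_q$, $P(\infty)=\mathrm{P}(1,0,0,0)$; the same formula defines $P(t)$ for $t\in\mathbb{F}_{q^2}$. The osculating plane at $P(t)$ is $\pi(t): x_0-3tx_1+3t^2x_2-t^3x_3=0$ for $t$ in $\mathbb{F}_q$ (or $\mathbb{F}_{q^2}$), and $\pi(\infty): x_3=0$. An imaginary chord is the line joining $P(t)$ and $P(t^q)$ for some $t\in\mathbb{F}_{q^2}\setminus\mathbb{F}_q$; an imaginary axis is the line $\pi(t)\cap\pi(t^q)$ for some $t\in\mathbb{F}_{q^2}\setminus\mathbb{F}_q$ (both are lines of $\mathrm{PG}(3,q)$). An $E_n\Gamma$-line is a line of $\mathrm{PG}(3,q)$ containing no point of $\mathcal{C}$, not contained in any osculating plane $\pi(t)$, $t\in\mathbb{F}_q\cup\{\infty\}$, and which is neither an imaginary chord nor an imaginary axis. -}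

module Defs where

open import Level using (0ℓ)
open import Data.Nat using (ℕ; zero; suc; _%_)
open import Data.Fin using (Fin)
open import Data.Product using (Σ; ∃; _×_; _,_)
open import Relation.Nullary using (¬_; Dec)
open import Relation.Binary.PropositionalEquality using (_≡_; _≢_)
open import Algebra.Structures using (IsCommutativeRing)
open import Algebra.Bundles.Raw using (RawRing)
open import Function.Bundles using (_↔_)

record FiniteField : Set₁ where
  infixl 7 _*_
  infixl 6 _+_
  infix  8 -_
  field
    Carrier   : Set
    _+_ _*_   : Carrier → Carrier → Carrier
    -_        : Carrier → Carrier
    0# 1#     : Carrier
    isCommutativeRing : IsCommutativeRing _≡_ _+_ _*_ -_ 0# 1#
    0≢1       : 0# ≢ 1#
    inverse   : ∀ x → x ≢ 0# → Σ Carrier (λ y → x * y ≡ 1#)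
    _≟_       : (x y : Carrier) → Dec (x ≡ y)
    q         : ℕ
    enum      : Carrier ↔ Fin q

  rawRing : RawRing 0ℓ 0ℓ
  rawRing = record { Carrier = Carrier ; _≈_ = _≡_ ; _+_ = _+_ ; _*_ = _*_
                   ; -_ = -_ ; 0# = 0# ; 1# = 1# }

record V4 (A : Set) : Set where
  constructor v4
  field x0 x1 x2 x3 : A

module Geometry (R : RawRing 0ℓ 0ℓ) where
  open RawRing R

  infixl 6 _-_
  _-_ : Carrier → Carrier → Carrier
  a - b = a + (- b)

  three : Carrier
  three = 1# + 1# + 1#

  cubicPt : Carrier → V4 Carrier
  cubicPt t = v4 (t * t * t) (t * t) t 1#

  cubicPtInf : V4 Carrier
  cubicPtInf = v4 1# 0# 0# 0#

  OnOsc : Carrier → V4 Carrier → Set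
  OnOsc t (v4 a b c d) =
    a - three * t * b + three * t * t * c - t * t * t * d ≈ 0#

  OnOscInf : V4 Carrier → Set
  OnOscInf (v4 a b c d) = d ≈ 0#

  lin : Carrier → V4 Carrier → Carrier → V4 Carrier → V4 Carrier
  lin α (v4 a b c d) β (v4 a' b' c' d') =
    v4 (α * a + β * a') (α * b + β * b') (α * c + β * c') (α * d + β * d')

  _≈V_ : V4 Carrier → V4 Carrier → Set
  v4 a b c d ≈V v4 a' b' c' d' = (a ≈ a') × (b ≈ b') × (c ≈ c') × (d ≈ d')

  InSpan : V4 Carrier → V4 Carrier → V4 Carrier → Set
  InSpan u w v = ∃ λ α → ∃ λ β → v ≈V lin α u β w

  LineInOsc : Carrier → V4 Carrier → V4 Carrier → Set
  LineInOsc t u w = OnOsc t u × OnOsc t w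

  LineInOscInf : V4 Carrier → V4 Carrier → Set
  LineInOscInf u w = OnOscInf u × OnOscInf w

  pow : Carrier → ℕ → Carrier
  pow t zero    = 1#
  pow t (suc n) = t * pow t n

-- The quadratic extension F_{q^2} = F[ω]/(ω^2 - c1 ω - c0), for an
-- irreducible ω^2 - c1 ω - c0; a + bω is represented by the pair (a , b).

module _ (F : FiniteField) where
  open FiniteField F

  Irreducible : Carrier → Carrier → Set
  Irreducible c0 c1 = ∀ x → x * x ≢ c1 * x + c0

  ExtRing : Carrier → Carrier → RawRing 0ℓ 0ℓ
  ExtRing c0 c1 = record
    { Carrier = Carrier × Carrier
    ; _≈_ = _≡_
    ; _+_ = λ { (a , b) (c , d) → (a + c , b + d) }
    ; _*_ = λ { (a , b) (c , d) →
                (a * c + b * d * c0 , a * d + b * c + b * d * c1) }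
    ; -_  = λ { (a , b) → (- a , - b) }
    ; 0#  = (0# , 0#)
    ; 1#  = (1# , 0#)
    }

  ι : Carrier → Carrier × Carrier
  ι a = (a , 0#)

  ιV : V4 Carrier → V4 (Carrier × Carrier)
  ιV (v4 a b c d) = v4 (ι a) (ι b) (ι c) (ι d)

  NotInBase : Carrier × Carrier → Set
  NotInBase (a , b) = b ≢ 0#

  module _ (c0 c1 : Carrier) where
    private
      module G = Geometry rawRing
      module H = Geometry (ExtRing c0 c1)

    frob : Carrier × Carrier → Carrier × Carrier
    frob t = H.pow t q

    -- the line ⟨u,w⟩ of PG(3,q) is the imaginary chord P(t)P(t^q)
    -- (P(t) ≠ P(t^q) for t ∉ F_q, so both lying on the line determines it)
    ImaginaryChord : V4 Carrier → V4 Carrier → Set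
    ImaginaryChord u w = ∃ λ t → NotInBase t ×
      H.InSpan (ιV u) (ιV w) (H.cubicPt t) ×
      H.InSpan (ιV u) (ιV w) (H.cubicPt (frob t))

    -- the line ⟨u,w⟩ is the imaginary axis π(t) ∩ π(t^q)
    -- (π(t) ≠ π(t^q) for t ∉ F_q, so containment determines the line)
    ImaginaryAxis : V4 Carrier → V4 Carrier → Set
    ImaginaryAxis u w = ∃ λ t → NotInBase t ×
      H.LineInOsc t (ιV u) (ιV w) × H.LineInOsc (frob t) (ιV u) (ιV w)

    -- E_nΓ-line (for the line spanned by linearly independent u, w)
    EnΓLine : V4 Carrier → V4 Carrier → Set
    EnΓLine u w =
      (∀ t → ¬ G.InSpan u w (G.cubicPt t)) × ¬ G.InSpan u w G.cubicPtInf ×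
      (∀ t → ¬ G.LineInOsc t u w) × ¬ G.LineInOscInf u w ×
      ¬ ImaginaryChord u w × ¬ ImaginaryAxis u w

  uL wL : V4 Carrier
  uL = v4 1# 0# 0# 1#
  wL = v4 0# 0# 1# 0#

{-# OPTIONS --safe #-}
-- Every point of L satisfies x₁ = 0 and x₀ = x₃, so P(t) ∈ L would force t² = 0 and t³ = 1, which is
-- impossible in any nonzero commutative ring; and P(∞) has x₀ ≠ x₃. An osculating plane π(t) contains L
-- only if t³ = 1 and 3t² = 0, whence 3 = 0. Both arguments run verbatim over the ring F_q[ω]/(ω² − c₁ω − c₀),
-- so imaginary chords and axes are excluded without using irreducibility, the Frobenius or t ∉ F_q.
-- Finally 3 ≠ 0 in F_q, because q · 1 = 0 (translating by 1 permutes F_q and leaves the sum of its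
-- elements unchanged) while 3 ∤ q.
module Submission where

open import Defs
open import Level using (0ℓ)
open import Algebra.Bundles using (CommutativeRing; Ring; AbelianGroup)
open import Algebra.Bundles.Raw using (RawRing)
open import Algebra.Core using (Op₁; Op₂)
open import Algebra.Definitions using (Associative; Commutative; LeftIdentity; _DistributesOverʳ_)
open import Algebra.Structures using (IsAbelianGroup; IsCommutativeRing)
open import Algebra.Consequences.Propositional using (comm∧idˡ⇒id; comm∧distrʳ⇒distrˡ)
import Algebra.Properties.CommutativeMonoid.Sum as CommutativeMonoidSum
import Algebra.Properties.Group as GroupProperties
import Algebra.Properties.Monoid.Mult as MonoidMult
import Algebra.Properties.Monoid.Sum as MonoidSum
import Algebra.Solver.Ring.NaturalCoefficients.Default as NaturalCoefficientsSolver
open import Data.Empty using (⊥-elim)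
open import Data.Fin using (Fin)
open import Data.Fin.Permutation using (Permutation)
open import Data.Nat using (ℕ; suc; _%_)
open import Data.Nat.DivMod using ([m+n]%n≡m%n)
import Data.Nat.Properties as ℕ
open import Data.Product using (_,_; proj₁; proj₂)
open import Function.Base using (_∘_)
open import Function.Bundles using (_↔_; Inverse; mk↔ₛ′)
open import Function.Construct.Composition using (_↔-∘_)
open import Function.Construct.Symmetry using (↔-sym)
open import Relation.Binary.PropositionalEquality as ≡ using (_≡_; _≢_)
import Relation.Binary.Reasoning.Setoid as SetoidReasoning

module FiniteAbelianGroup {A : Set} {_+_ : Op₂ A} {0# : A} { -_ : Op₁ A}
    (isAbelianGroup : IsAbelianGroup _≡_ _+_ 0# -_) {n : ℕ} (enum : A ↔ Fin n) where

  private
    G : AbelianGroup 0ℓ 0ℓ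
    G = record { isAbelianGroup = isAbelianGroup }
    open AbelianGroup G using (group; monoid; commutativeMonoid)
    open GroupProperties group using (//-rightDividesˡ; //-rightDividesʳ; identityʳ-unique)
    open MonoidSum monoid using (sum-cong-≗; sum-replicate)
    open CommutativeMonoidSum commutativeMonoid using (sum; sum-permute; ∑-distrib-+)
    open Inverse enum using (from; strictlyInverseʳ)
    open ≡.≡-Reasoning

  open MonoidMult monoid using (_×_)

  +-translation : A → A ↔ A
  +-translation x = mk↔ₛ′ (_+ x) (λ y → y + (- x)) (//-rightDividesˡ x) (//-rightDividesʳ x)

  order×x≡0 : ∀ x → n × x ≡ 0#
  order×x≡0 x = identityʳ-unique (sum from) (n × x) (begin
    sum from + (n × x)                      ≡⟨ ≡.cong (sum from +_) (sum-replicate n) ⟨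
    sum from + sum {n} (λ _ → x)            ≡⟨ ∑-distrib-+ from (λ _ → x) ⟨
    sum (λ i → from i + x)                  ≡⟨ sum-cong-≗ (λ i → strictlyInverseʳ (from i + x)) ⟨
    sum (from ∘ Inverse.to shift)    ≡⟨ sum-permute from shift ⟨
    sum from                                ∎)
    where
    shift : Permutation n n
    shift = enum ↔-∘ (+-translation x ↔-∘ ↔-sym enum)

module RingCharacteristic {c ℓ} (R : Ring c ℓ) where
  open Ring R
  open MonoidMult +-monoid using (_×_)
  open SetoidReasoning setoid

  three≈0⇒[n×1≈0⇒n%3≡0] : 1# ≉ 0# → 1# + 1# + 1# ≈ 0# → ∀ n → n × 1# ≈ 0# → n % 3 ≡ 0
  three≈0⇒[n×1≈0⇒n%3≡0] 1≉0 three≈0 = go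
    where
    go : ∀ n → n × 1# ≈ 0# → n % 3 ≡ 0
    go 0 _ = ≡.refl
    go 1 1≈0 = ⊥-elim (1≉0 (trans (sym (+-identityʳ 1#)) 1≈0))
    go 2 2≈0 = ⊥-elim (1≉0 (begin
      1#                     ≈⟨ +-identityʳ 1# ⟨
      1# + 0#                ≈⟨ +-congˡ 2≈0 ⟨
      1# + (1# + (1# + 0#))  ≈⟨ +-assoc 1# 1# (1# + 0#) ⟨
      1# + 1# + (1# + 0#)    ≈⟨ +-congˡ (+-identityʳ 1#) ⟩
      1# + 1# + 1#           ≈⟨ three≈0 ⟩
      0#                     ∎))
    go (suc (suc (suc m))) 3+m≈0 =
      ≡.trans (≡.cong (_% 3) (ℕ.+-comm 3 m)) (≡.trans ([m+n]%n≡m%n m 3) (go m m≈0))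
      where
      m≈0 : m × 1# ≈ 0#
      m≈0 = begin
        m × 1#                       ≈⟨ +-identityˡ (m × 1#) ⟨
        0# + m × 1#                  ≈⟨ +-congʳ three≈0 ⟨
        1# + 1# + 1# + m × 1#        ≈⟨ +-assoc (1# + 1#) 1# (m × 1#) ⟩
        1# + 1# + (1# + m × 1#)      ≈⟨ +-assoc 1# 1# (1# + m × 1#) ⟩
        1# + (1# + (1# + m × 1#))    ≈⟨ 3+m≈0 ⟩
        0#                           ∎

module TwistedCubicLine (R : CommutativeRing 0ℓ 0ℓ) where
  open CommutativeRing R hiding (_-_)
  open import Data.Product using (_×_)
  open Geometry rawRing
  open GroupProperties +-group using (x∙y⁻¹≈ε⇒x≈y)
  open NaturalCoefficientsSolver commutativeSemiring
  open SetoidReasoning setoid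

  u w : V4 Carrier
  u = v4 1# 0# 0# 1#
  w = v4 0# 0# 1# 0#

  inSpan⇒x₁≈0∧x₀≈x₃ : ∀ {a b c d} → InSpan u w (v4 a b c d) → b ≈ 0# × a ≈ d
  inSpan⇒x₁≈0∧x₀≈x₃ (α , β , a≈ , b≈ , _ , d≈) =
      trans b≈ (solve 2 (λ α β → α :* con 0 :+ β :* con 0 := con 0) refl α β)
    , trans a≈ (sym d≈)

  cubicPt-inSpan⇒1≈0 : ∀ t → InSpan u w (cubicPt t) → 1# ≈ 0#
  cubicPt-inSpan⇒1≈0 t P[t]∈L with inSpan⇒x₁≈0∧x₀≈x₃ P[t]∈L
  ... | t²≈0 , t³≈1 = begin
    1#         ≈⟨ t³≈1 ⟨
    t * t * t  ≈⟨ *-congʳ t²≈0 ⟩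
    0# * t     ≈⟨ zeroˡ t ⟩
    0#         ∎

  cubicPtInf-inSpan⇒1≈0 : InSpan u w cubicPtInf → 1# ≈ 0#
  cubicPtInf-inSpan⇒1≈0 P[∞]∈L = proj₂ (inSpan⇒x₁≈0∧x₀≈x₃ P[∞]∈L)

  -- Clearing the subtractions makes the plane equations accessible to the semiring solver.
  x-y+z-w≈0⇒x+z≈y+w : ∀ x y z w → x - y + z - w ≈ 0# → x + z ≈ y + w
  x-y+z-w≈0⇒x+z≈y+w x y z w eq = begin
    x + z                ≈⟨ +-identityʳ (x + z) ⟨
    x + z + 0#           ≈⟨ +-congˡ (-‿inverseˡ y) ⟨
    x + z + (- y + y)    ≈⟨ solve 4 (λ x y′ z y → x :+ z :+ (y′ :+ y) := x :+ y′ :+ z :+ y) refl x (- y) z y ⟩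
    x - y + z + y        ≈⟨ +-congʳ (x∙y⁻¹≈ε⇒x≈y (x - y + z) w eq) ⟩
    w + y                ≈⟨ +-comm w y ⟩
    y + w                ∎

  onOsc⇒balanced : ∀ t {a b c d} → OnOsc t (v4 a b c d) →
                   a + three * t * t * c ≈ three * t * b + t * t * t * d
  onOsc⇒balanced t {a} {b} {c} {d} = x-y+z-w≈0⇒x+z≈y+w a (three * t * b) (three * t * t * c) (t * t * t * d)

  lineInOsc⇒three≈0 : ∀ t → LineInOsc t u w → three ≈ 0#
  lineInOsc⇒three≈0 t (u∈π[t] , w∈π[t]) = begin
    three                ≈⟨ *-identityʳ three ⟨
    three * 1#           ≈⟨ *-congˡ t³≈1 ⟨
    three * (t * t * t)  ≈⟨ solve 2 (λ h t → h :* (t :* t :* t) := h :* t :* t :* t) refl three t ⟩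
    three * t * t * t    ≈⟨ *-congʳ 3t²≈0 ⟩
    0# * t               ≈⟨ zeroˡ t ⟩
    0#                   ∎
    where
    t³≈1 : t * t * t ≈ 1#
    t³≈1 = begin
      t * t * t                           ≈⟨ solve 2 (λ h t → t :* t :* t := h :* t :* con 0 :+ t :* t :* t :* con 1) refl three t ⟩
      three * t * 0# + t * t * t * 1#     ≈⟨ onOsc⇒balanced t u∈π[t] ⟨
      1# + three * t * t * 0#             ≈⟨ solve 2 (λ h t → con 1 :+ h :* t :* t :* con 0 := con 1) refl three t ⟩
      1#                                  ∎
    3t²≈0 : three * t * t ≈ 0#
    3t²≈0 = begin
      three * t * t                       ≈⟨ solve 2 (λ h t → h :* t :* t := con 0 :+ h :* t :* t :* con 1) refl three t ⟩
      0# + three * t * t * 1#             ≈⟨ onOsc⇒balanced t w∈π[t] ⟩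
      three * t * 0# + t * t * t * 0#     ≈⟨ solve 2 (λ h t → h :* t :* con 0 :+ t :* t :* t :* con 0 := con 0) refl three t ⟩
      0#                                  ∎

commutativeRing : FiniteField → CommutativeRing 0ℓ 0ℓ
commutativeRing F = record { isCommutativeRing = FiniteField.isCommutativeRing F }

three≢0 : (F : FiniteField) → FiniteField.q F % 3 ≢ 0 →
          Geometry.three (FiniteField.rawRing F) ≢ FiniteField.0# F
three≢0 F q%3≢0 three≡0 =
  q%3≢0 (three≈0⇒[n×1≈0⇒n%3≡0] (0≢1 ∘ ≡.sym) three≡0 q (order×x≡0 1#))
  where
  open FiniteField F using (0≢1; q; enum; isCommutativeRing; 1#)
  open IsCommutativeRing isCommutativeRing using (+-isAbelianGroup)
  open RingCharacteristic (CommutativeRing.ring (commutativeRing F))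
  open FiniteAbelianGroup +-isAbelianGroup enum using (order×x≡0)

module ExtensionRing (F : FiniteField) (c0 c1 : FiniteField.Carrier F) where
  open FiniteField F using (isCommutativeRing)
  open IsCommutativeRing isCommutativeRing
    using (+-assoc; +-comm; +-identityˡ; +-identityʳ; -‿inverseˡ; -‿inverseʳ)
  open NaturalCoefficientsSolver (CommutativeRing.commutativeSemiring (commutativeRing F))
  private module E = RawRing (ExtRing F c0 c1)

  +-isAbelianGroup : IsAbelianGroup _≡_ E._+_ E.0# E.-_
  +-isAbelianGroup = record
    { isGroup = record
      { isMonoid = record
        { isSemigroup = record
          { isMagma = record { isEquivalence = ≡.isEquivalence ; ∙-cong = ≡.cong₂ E._+_ }
          ; assoc   = λ (a , b) (c , d) (e , f) → ≡.cong₂ _,_ (+-assoc a c e) (+-assoc b d f)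
          }
        ; identity = (λ (a , b) → ≡.cong₂ _,_ (+-identityˡ a) (+-identityˡ b))
                   , (λ (a , b) → ≡.cong₂ _,_ (+-identityʳ a) (+-identityʳ b))
        }
      ; inverse = (λ (a , b) → ≡.cong₂ _,_ (-‿inverseˡ a) (-‿inverseˡ b))
                , (λ (a , b) → ≡.cong₂ _,_ (-‿inverseʳ a) (-‿inverseʳ b))
      ; ⁻¹-cong = ≡.cong E.-_
      }
    ; comm = λ (a , b) (c , d) → ≡.cong₂ _,_ (+-comm a c) (+-comm b d)
    }

  *-comm : Commutative _≡_ E._*_
  *-comm (a , b) (c , d) = ≡.cong₂ _,_
    (solve 5 (λ a b c d c0 → a :* c :+ b :* d :* c0 := c :* a :+ d :* b :* c0) ≡.refl a b c d c0)
    (solve 5 (λ a b c d c1 → a :* d :+ b :* c :+ b :* d :* c1 := c :* b :+ d :* a :+ d :* b :* c1) ≡.refl a b c d c1)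

  *-assoc : Associative _≡_ E._*_
  *-assoc (a , b) (c , d) (e , f) = ≡.cong₂ _,_
    (solve 8 (λ a b c d e f c0 c1 →
        (a :* c :+ b :* d :* c0) :* e :+ (a :* d :+ b :* c :+ b :* d :* c1) :* f :* c0
      := a :* (c :* e :+ d :* f :* c0) :+ b :* (c :* f :+ d :* e :+ d :* f :* c1) :* c0)
      ≡.refl a b c d e f c0 c1)
    (solve 8 (λ a b c d e f c0 c1 →
        (a :* c :+ b :* d :* c0) :* f :+ (a :* d :+ b :* c :+ b :* d :* c1) :* e
          :+ (a :* d :+ b :* c :+ b :* d :* c1) :* f :* c1
      := a :* (c :* f :+ d :* e :+ d :* f :* c1) :+ b :* (c :* e :+ d :* f :* c0)
          :+ b :* (c :* f :+ d :* e :+ d :* f :* c1) :* c1)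
      ≡.refl a b c d e f c0 c1)

  *-identityˡ : LeftIdentity _≡_ E.1# E._*_
  *-identityˡ (c , d) = ≡.cong₂ _,_
    (solve 3 (λ c d c0 → con 1 :* c :+ con 0 :* d :* c0 := c) ≡.refl c d c0)
    (solve 3 (λ c d c1 → con 1 :* d :+ con 0 :* c :+ con 0 :* d :* c1 := d) ≡.refl c d c1)

  *-distribʳ-+ : _DistributesOverʳ_ _≡_ E._*_ E._+_
  *-distribʳ-+ (a , b) (c , d) (e , f) = ≡.cong₂ _,_
    (solve 7 (λ a b c d e f c0 →
      (c :+ e) :* a :+ (d :+ f) :* b :* c0 := (c :* a :+ d :* b :* c0) :+ (e :* a :+ f :* b :* c0))
      ≡.refl a b c d e f c0)
    (solve 7 (λ a b c d e f c1 →
        (c :+ e) :* b :+ (d :+ f) :* a :+ (d :+ f) :* b :* c1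
      := (c :* b :+ d :* a :+ d :* b :* c1) :+ (e :* b :+ f :* a :+ f :* b :* c1))
      ≡.refl a b c d e f c1)

  extensionRing : CommutativeRing 0ℓ 0ℓ
  extensionRing = record
    { isCommutativeRing = record
      { isRing = record
        { +-isAbelianGroup = +-isAbelianGroup
        ; *-cong           = ≡.cong₂ E._*_
        ; *-assoc          = *-assoc
        ; *-identity       = comm∧idˡ⇒id *-comm *-identityˡ
        ; distrib          = comm∧distrʳ⇒distrˡ *-comm *-distribʳ-+ , *-distribʳ-+
        }
      ; *-comm = *-comm
      }
    }

lemma3p1 : (F : FiniteField) → FiniteField.q F % 3 ≢ 0 →
    (c0 c1 : FiniteField.Carrier F) → Irreducible F c0 c1 →
    EnΓLine F c0 c1 (uL F) (wL F)
lemma3p1 F q%3≢0 c0 c1 _ =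
    (λ t → 1≢0 ∘ Base.cubicPt-inSpan⇒1≈0 t)
  , 1≢0 ∘ Base.cubicPtInf-inSpan⇒1≈0
  , (λ t → 3≢0 ∘ Base.lineInOsc⇒three≈0 t)
  , (λ (u∈π[∞] , _) → 1≢0 u∈π[∞])
  , (λ (t , _ , P[t]∈L , _) → 1≢0 (≡.cong proj₁ (Ext.cubicPt-inSpan⇒1≈0 t P[t]∈L)))
  , (λ (t , _ , L⊆π[t] , _) → 3≢0 (≡.cong proj₁ (Ext.lineInOsc⇒three≈0 t L⊆π[t])))
  where
  open FiniteField F using (0≢1; 0#; 1#)
  module Base = TwistedCubicLine (commutativeRing F)
  module Ext = TwistedCubicLine (ExtensionRing.extensionRing F c0 c1)

  1≢0 : 1# ≢ 0#
  1≢0 = 0≢1 ∘ ≡.sym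

  3≢0 : Geometry.three (FiniteField.rawRing F) ≢ 0#
  3≢0 = three≢0 F q%3≢0
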